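{- Let $G$ be a finite simple graph with $m$ edges. Then $G$ is a disjoint union of stars and triangles if and only if the skeleton $\mathcal{G}(\mathcal{M}(G))$ of the matching polytope of $G$ is an $m$-regular graph.
   Context: A star is a complete bipartite graph $K_{1,t}$ with $t\ge 0$ (for $t=0$ a single vertex); a triangle is $K_3$. A matching of $G=(V,E)$ is a set of pairwise disjoint edges (the empty set included); $\chi_F\in\mathbb{R}^E$ denotes the incidence vector of $F\subseteq E$. The matching polytope $\mathcal{M}(G)$ is the convex hull of the incidence vectors of all matchings of $G$, whose vertices are exactly these vectors. The skeleton $\mathcal{G}(\mathcal{M}(G))$ is the graph whose vertices and edges are the vertices and edges (1-dimensional faces) of $\mathcal{M}(G)$.
   Formalization: The linear functionals that expose the edges of the skeleton $\mathcal{G}(\mathcal{M}(G))$ have rational coefficients rather than real ones. -}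

module Defs where

open import Data.Nat using (ℕ)
open import Data.Fin using (Fin; zero; suc)
open import Data.Fin.Subset using (Subset; _∈_)
open import Data.Vec using (lookup)
open import Data.Bool using (if_then_else_)
open import Data.Product using (Σ; ∃; _×_; _,_; proj₁; proj₂)
open import Data.Sum using (_⊎_)
open import Function.Bundles using (_⇔_)
open import Relation.Binary.PropositionalEquality using (_≡_; _≢_)
open import Data.Rational using (ℚ; 0ℚ; 1ℚ; _+_; _*_; _<_)

SameEdge : ∀ {n} → Fin n × Fin n → Fin n × Fin n → Set
SameEdge (a , b) (c , d) = (a ≡ c × b ≡ d) ⊎ (a ≡ d × b ≡ c)

-- A finite simple graph on vertex set Fin n with exactly m edges,
-- the edges being labelled by Fin m (so E = Fin m).
record SimpleGraph (n m : ℕ) : Set where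
  field
    ends       : Fin m → Fin n × Fin n
    loopless   : ∀ e → proj₁ (ends e) ≢ proj₂ (ends e)
    noParallel : ∀ e f → SameEdge (ends e) (ends f) → e ≡ f

module _ {n m : ℕ} (G : SimpleGraph n m) where
  open SimpleGraph G

  Adj : Fin n → Fin n → Set
  Adj u v = ∃ λ e → SameEdge (ends e) (u , v)

  Disjoint : Fin m → Fin m → Set
  Disjoint e f = proj₁ (ends e) ≢ proj₁ (ends f) × proj₁ (ends e) ≢ proj₂ (ends f)
               × proj₂ (ends e) ≢ proj₁ (ends f) × proj₂ (ends e) ≢ proj₂ (ends f)

  IsMatching : Subset m → Set
  IsMatching F = ∀ e f → e ∈ F → f ∈ F → e ≢ f → Disjoint e f

  -- Part j of a vertex partition p induces a star K_{1,t} (t ≥ 0) with centre c.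
  StarPart : ∀ {k} → (Fin n → Fin k) → Fin k → Set
  StarPart p j = ∃ λ c → p c ≡ j ×
    (∀ x y → p x ≡ j → p y ≡ j → (Adj x y ⇔ ((x ≡ c × y ≢ c) ⊎ (y ≡ c × x ≢ c))))

  TrianglePart : ∀ {k} → (Fin n → Fin k) → Fin k → Set
  TrianglePart p j = Σ (Fin n) λ a → Σ (Fin n) λ b → Σ (Fin n) λ c →
    a ≢ b × a ≢ c × b ≢ c × p a ≡ j × p b ≡ j × p c ≡ j ×
    (∀ x → p x ≡ j → (x ≡ a ⊎ x ≡ b ⊎ x ≡ c)) ×
    Adj a b × Adj a c × Adj b c

  DisjointUnionOfStarsAndTriangles : Set
  DisjointUnionOfStarsAndTriangles =
    Σ ℕ λ k → Σ (Fin n → Fin k) λ p →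
      (∀ u v → Adj u v → p u ≡ p v) ×
      (∀ j → StarPart p j ⊎ TrianglePart p j)

Σℚ : ∀ {m} → (Fin m → ℚ) → ℚ
Σℚ {ℕ.zero}  f = 0ℚ
Σℚ {ℕ.suc m} f = f zero + Σℚ (λ i → f (suc i))

χ : ∀ {m} → Subset m → Fin m → ℚ
χ F e = if lookup F e then 1ℚ else 0ℚ

_·_ : ∀ {m} → (Fin m → ℚ) → (Fin m → ℚ) → ℚ
c · x = Σℚ (λ e → c e * x e)

module _ {n m : ℕ} (G : SimpleGraph n m) where

  -- χ_M and χ_N (M ≠ N) span an edge (1-dimensional face) of the matching polytope:
  -- some linear functional c is maximised over M(G) exactly on conv{χ_M, χ_N},
  -- i.e. c·χ_M = c·χ_N and c·χ_W < c·χ_M for every other matching W.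
  SkeletonAdj : Subset m → Subset m → Set
  SkeletonAdj M N = IsMatching G M × IsMatching G N × M ≢ N ×
    ∃ λ (c : Fin m → ℚ) → (c · χ M ≡ c · χ N) ×
      (∀ W → IsMatching G W → W ≢ M → W ≢ N → c · χ W < c · χ M)

  SkeletonRegular : ℕ → Set
  SkeletonRegular d = ∀ M → IsMatching G M →
    Σ (Fin d → Subset m) λ f →
      (∀ i j → f i ≡ f j → i ≡ j) ×
      (∀ i → SkeletonAdj M (f i)) ×
      (∀ N → SkeletonAdj M N → ∃ λ i → f i ≡ N)

-- Call two edges touching when they share a vertex.  G is a disjoint union of stars and
-- triangles exactly when touching is transitive: its classes are then families of pairwise
-- touching edges, i.e. stars or triangles.  A matching then uses at most one edge per class,
-- and the neighbours of a matching M in the skeleton are the m matchings toggle M g, which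
-- change M's choice inside the class of g only.  Every neighbour N is of this form, since if
-- M and N differed in two classes, recombining them class by class would give two other
-- matchings with the same midpoint as M and N.  Conversely, if touching is not transitive
-- there is a path e–f–g with e and g disjoint, and {e, g} is a neighbour of {f} besides the
-- m matchings toggle {f} h, so the skeleton is not m-regular.  Each adjacency is certified
-- by a linear functional whose maximum over the matchings is attained exactly at the two
-- matchings: any other matching W is beaten by one of them coordinate by coordinate.

module Submission where

open import Defs
open import Data.Nat using (ℕ)
import Data.Nat as ℕ
import Data.Nat.Properties as ℕ
open import Function.Bundles using (_⇔_)

open import Algebra.Bundles using (CommutativeMonoid)
open import Data.Bool using (Bool; true; false; if_then_else_; not)
import Data.Bool as Bool
open import Data.Bool.Properties using (not-¬; ¬-not; not-injective)
open import Data.Empty using (⊥; ⊥-elim)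
open import Data.Fin using (Fin; zero; suc; _≟_)
open import Data.Fin.Properties using (any?; ¬∀⟶∃¬; suc-injective; injective⇒≤)
open import Data.Fin.Subset using (Subset) renaming (⊥ to ∅)
open import Data.Product using (∃; ∃₂; _×_; _,_; proj₁; proj₂)
open import Data.Rational using (ℚ; 0ℚ; 1ℚ; _+_; _*_; _<_; _≤_; -_; Positive)
open import Data.Rational.Properties
  using (≤-refl; <⇒≤; <-irrefl; +-mono-≤; +-mono-<-≤; +-mono-≤-<; +-mono-<; +-assoc; +-comm;
         +-identityˡ; *-zeroˡ; *-zeroʳ; *-identityʳ; *-distribˡ-+;
         positive⁻¹; negative⁻¹; +-0-commutativeMonoid)
open import Data.Sum using (_⊎_; inj₁; inj₂)
open import Data.Vec using (lookup; tabulate; _[_]≔_)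
open import Data.Vec.Properties
  using (tabulate∘lookup; tabulate-cong; lookup∘tabulate; lookup-replicate; lookup∘update; lookup∘update′;
         []≔-idempotent; []≔-lookup; []=⇒lookup; lookup⇒[]=)
open import Function using (_∘_)
open import Function.Bundles using (mk⇔; Equivalence)
open import Relation.Binary.Definitions using (Transitive; Decidable)
open import Relation.Binary.Structures using (IsEquivalence)
open import Relation.Nullary using (¬_; Dec; yes; no; does)
open import Relation.Nullary.Decidable using (_⊎-dec_; _×-dec_; ¬?; dec-true; dec-false; does-⇔; decidable-stable)
open import Relation.Binary.PropositionalEquality
  using (_≡_; _≢_; refl; sym; trans; cong; cong₂; subst; subst₂; module ≡-Reasoning)
open import Algebra.Properties.CommutativeSemigroup
  (CommutativeMonoid.commutativeSemigroup +-0-commutativeMonoid) using (interchange; xy∙z≈xz∙y)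

module _ {A : Set} where

  _∈₂_ : A → A × A → Set
  x ∈₂ (a , b) = x ≡ a ⊎ x ≡ b

  _∈₃_ : A → A × A × A → Set
  x ∈₃ (a , bc) = x ≡ a ⊎ x ∈₂ bc

  Meet : A × A → A × A → Set
  Meet p q = ∃ λ v → v ∈₂ p × v ∈₂ q

  Meet-sym : ∀ {p q} → Meet p q → Meet q p
  Meet-sym (v , v∈p , v∈q) = v , v∈q , v∈p

  partner : ∀ {x p} → x ∈₂ p → A
  partner {p = _ , b} (inj₁ _) = b
  partner {p = a , _} (inj₂ _) = a

  partner-∈₂ : ∀ {x p} (x∈ : x ∈₂ p) → partner x∈ ∈₂ p
  partner-∈₂ (inj₁ _) = inj₂ refl
  partner-∈₂ (inj₂ _) = inj₁ refl

  partner-≢ : ∀ {x p} → proj₁ p ≢ proj₂ p → (x∈ : x ∈₂ p) → x ≢ partner x∈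
  partner-≢ a≢b (inj₁ refl) = a≢b
  partner-≢ a≢b (inj₂ refl) = a≢b ∘ sym

  ∈₂-partner : ∀ {x z p} (x∈ : x ∈₂ p) → z ∈₂ p → z ≡ x ⊎ z ≡ partner x∈
  ∈₂-partner (inj₁ refl) z∈ = z∈
  ∈₂-partner (inj₂ refl) z∈ = Data.Sum.swap z∈

  ∈₂-cover : ∀ {x y z p} → x ≢ y → x ∈₂ p → y ∈₂ p → z ∈₂ p → z ∈₂ (x , y)
  ∈₂-cover x≢y (inj₁ refl) (inj₁ refl) _ = ⊥-elim (x≢y refl)
  ∈₂-cover x≢y (inj₁ refl) (inj₂ refl) z∈ = z∈
  ∈₂-cover x≢y (inj₂ refl) (inj₁ refl) z∈ = Data.Sum.swap z∈
  ∈₂-cover x≢y (inj₂ refl) (inj₂ refl) _ = ⊥-elim (x≢y refl)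

  ∈₃-corner-or-side : ∀ {t x y} → x ∈₃ t → y ∈₃ t →
    proj₁ t ∈₂ (x , y) ⊎ (x ∈₂ proj₂ t × y ∈₂ proj₂ t)
  ∈₃-corner-or-side (inj₁ refl) _ = inj₁ (inj₁ refl)
  ∈₃-corner-or-side (inj₂ _) (inj₁ refl) = inj₁ (inj₂ refl)
  ∈₃-corner-or-side (inj₂ x∈) (inj₂ y∈) = inj₂ (x∈ , y∈)

  side-meets : ∀ t {x₁ y₁ x₂ y₂} → x₁ ≢ y₁ → x₁ ∈₂ proj₂ t → y₁ ∈₂ proj₂ t →
    x₂ ≢ y₂ → x₂ ∈₃ t → y₂ ∈₃ t → Meet (x₁ , y₁) (x₂ , y₂)
  side-meets t d₁ x₁∈ y₁∈ d₂ (inj₂ x₂∈) _ = _ , ∈₂-cover d₁ x₁∈ y₁∈ x₂∈ , inj₁ refl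
  side-meets t d₁ x₁∈ y₁∈ d₂ (inj₁ refl) (inj₂ y₂∈) = _ , ∈₂-cover d₁ x₁∈ y₁∈ y₂∈ , inj₂ refl
  side-meets t d₁ x₁∈ y₁∈ d₂ (inj₁ refl) (inj₁ refl) = ⊥-elim (d₂ refl)

  pairs-in-triple-meet : ∀ t {x₁ y₁ x₂ y₂} → x₁ ≢ y₁ → x₂ ≢ y₂ →
    x₁ ∈₃ t → y₁ ∈₃ t → x₂ ∈₃ t → y₂ ∈₃ t → Meet (x₁ , y₁) (x₂ , y₂)
  pairs-in-triple-meet t d₁ d₂ x₁∈ y₁∈ x₂∈ y₂∈
    with ∈₃-corner-or-side {t} x₁∈ y₁∈ | ∈₃-corner-or-side {t} x₂∈ y₂∈
  ... | inj₁ a∈₁ | inj₁ a∈₂ = proj₁ t , a∈₁ , a∈₂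
  ... | inj₂ (x₁∈′ , y₁∈′) | _ = side-meets t d₁ x₁∈′ y₁∈′ d₂ x₂∈ y₂∈
  ... | inj₁ _ | inj₂ (x₂∈′ , y₂∈′) = Meet-sym (side-meets t d₂ x₂∈′ y₂∈′ d₁ x₁∈ y₁∈)

  no-common-vertex : ∀ {a b c v} → a ≢ b → a ≢ c → b ≢ c →
    v ∈₂ (a , b) → v ∈₂ (b , c) → v ∈₂ (a , c) → ⊥
  no-common-vertex a≢b a≢c b≢c (inj₁ refl) (inj₁ refl) _ = a≢b refl
  no-common-vertex a≢b a≢c b≢c (inj₁ refl) (inj₂ refl) _ = a≢c refl
  no-common-vertex a≢b a≢c b≢c (inj₂ refl) _ (inj₁ refl) = a≢b refl
  no-common-vertex a≢b a≢c b≢c (inj₂ refl) _ (inj₂ refl) = b≢c refl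

  pair-meeting-triangle : ∀ {a b c x p} → a ≢ b → a ≢ c → b ≢ c →
    Meet p (a , b) → Meet p (b , c) → Meet p (a , c) → x ∈₂ p → x ∈₃ (a , b , c)
  pair-meeting-triangle a≢b a≢c b≢c (z₁ , z₁∈p , z₁∈) (z₂ , z₂∈p , z₂∈) (z₃ , z₃∈p , z₃∈) x∈p
    with ∈₂-partner x∈p z₁∈p | ∈₂-partner x∈p z₂∈p | ∈₂-partner x∈p z₃∈p
  ... | inj₁ refl | _ | _ = Data.Sum.map₂ inj₁ z₁∈
  ... | _ | inj₁ refl | _ = inj₂ z₂∈
  ... | _ | _ | inj₁ refl = Data.Sum.map₂ inj₂ z₃∈
  ... | inj₂ refl | inj₂ refl | inj₂ refl = ⊥-elim (no-common-vertex a≢b a≢c b≢c z₁∈ z₂∈ z₃∈)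

  meet-without₁ : ∀ {p a b} → Meet p (a , b) → ¬ a ∈₂ p → b ∈₂ p
  meet-without₁ (_ , v∈p , inj₁ refl) a∉p = ⊥-elim (a∉p v∈p)
  meet-without₁ (_ , v∈p , inj₂ refl) _ = v∈p

  meet-without₂ : ∀ {p a b} → Meet p (a , b) → ¬ b ∈₂ p → a ∈₂ p
  meet-without₂ (_ , v∈p , inj₁ refl) _ = v∈p
  meet-without₂ (_ , v∈p , inj₂ refl) b∉p = ⊥-elim (b∉p v∈p)

  meet-map : ∀ {p q q′} → (∀ {v} → v ∈₂ q → v ∈₂ q′) → Meet p q → Meet p q′
  meet-map q⊆q′ (v , v∈p , v∈q) = v , v∈p , q⊆q′ v∈q

_∈₂?_ : ∀ {n} (v : Fin n) (p : Fin n × Fin n) → Dec (v ∈₂ p)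
v ∈₂? (a , b) = (v ≟ a) ⊎-dec (v ≟ b)

subset-ext : ∀ {m} {A B : Subset m} → (∀ e → lookup A e ≡ lookup B e) → A ≡ B
subset-ext {A = A} {B} A≗B = trans (sym (tabulate∘lookup A)) (trans (tabulate-cong A≗B) (tabulate∘lookup B))

subset-differ : ∀ {m} {A B : Subset m} → A ≢ B → ∃ λ e → lookup A e ≢ lookup B e
subset-differ {m} {A} {B} A≢B = ¬∀⟶∃¬ m _ (λ e → lookup A e Bool.≟ lookup B e) (A≢B ∘ subset-ext)

≢-witness : ∀ {m} {A B : Subset m} {e} → lookup A e ≢ lookup B e → A ≢ B
≢-witness Ae≢Be refl = Ae≢Be refl

false≢true : false ≢ true
false≢true ()

≢-by-member : ∀ {m} {A B : Subset m} {e} → lookup A e ≡ false → lookup B e ≡ true → A ≢ B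
≢-by-member Ae Be = ≢-witness λ Ae≡Be → false≢true (trans (sym Ae) (trans Ae≡Be Be))

insert-member : ∀ {m} {K : Subset m} {i x} → lookup (K [ i ]≔ true) x ≡ true → x ≡ i ⊎ lookup K x ≡ true
insert-member {K = K} {i} {x} x∈ with x ≟ i
... | yes x≡i = inj₁ x≡i
... | no x≢i = inj₂ (trans (sym (lookup∘update′ x≢i K true)) x∈)

singleton-member : ∀ {m} {f x : Fin m} → lookup (∅ [ f ]≔ true) x ≡ true → x ≡ f
singleton-member {x = x} x∈ with insert-member {K = ∅} x∈
... | inj₁ x≡f = x≡f
... | inj₂ x∈∅ = ⊥-elim (false≢true (trans (sym (lookup-replicate x false)) x∈∅))

pair-member : ∀ {m} {a b x : Fin m} → lookup (∅ [ a ]≔ true [ b ]≔ true) x ≡ true → x ∈₂ (a , b)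
pair-member x∈ with insert-member {K = ∅ [ _ ]≔ true} x∈
... | inj₁ x≡b = inj₂ x≡b
... | inj₂ x∈a = inj₁ (singleton-member x∈a)

insert-removed : ∀ {m} {M : Subset m} {h} → lookup M h ≡ true → (M [ h ]≔ false) [ h ]≔ true ≡ M
insert-removed {M = M} {h} Mh = trans ([]≔-idempotent M h) (trans (cong (M [ h ]≔_) (sym Mh)) ([]≔-lookup M h))

splice : ∀ {m} → (Fin m → Bool) → Subset m → Subset m → Subset m
splice S A B = tabulate λ e → if S e then lookup A e else lookup B e

splice-inside : ∀ {m} S (A B : Subset m) {e} → S e ≡ true → lookup (splice S A B) e ≡ lookup A e
splice-inside S A B {e} Se rewrite lookup∘tabulate (λ e → if S e then lookup A e else lookup B e) e | Se = refl

splice-outside : ∀ {m} S (A B : Subset m) {e} → S e ≡ false → lookup (splice S A B) e ≡ lookup B e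
splice-outside S A B {e} Se rewrite lookup∘tabulate (λ e → if S e then lookup A e else lookup B e) e | Se = refl

Σℚ-cong : ∀ {m} {f g : Fin m → ℚ} → (∀ e → f e ≡ g e) → Σℚ f ≡ Σℚ g
Σℚ-cong {ℕ.zero} _ = refl
Σℚ-cong {ℕ.suc m} f≗g = cong₂ _+_ (f≗g zero) (Σℚ-cong (f≗g ∘ suc))

Σℚ-mono-≤ : ∀ {m} {f g : Fin m → ℚ} → (∀ e → f e ≤ g e) → Σℚ f ≤ Σℚ g
Σℚ-mono-≤ {ℕ.zero} _ = ≤-refl
Σℚ-mono-≤ {ℕ.suc m} f≤g = +-mono-≤ (f≤g zero) (Σℚ-mono-≤ (f≤g ∘ suc))

Σℚ-mono-< : ∀ {m} {f g : Fin m → ℚ} → (∀ e → f e ≤ g e) → ∀ i → f i < g i → Σℚ f < Σℚ g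
Σℚ-mono-< f≤g zero fi<gi = +-mono-<-≤ fi<gi (Σℚ-mono-≤ (f≤g ∘ suc))
Σℚ-mono-< f≤g (suc i) fi<gi = +-mono-≤-< (f≤g zero) (Σℚ-mono-< (f≤g ∘ suc) i fi<gi)

Σℚ-distrib-+ : ∀ {m} (f g : Fin m → ℚ) → Σℚ (λ e → f e + g e) ≡ Σℚ f + Σℚ g
Σℚ-distrib-+ {ℕ.zero} _ _ = refl
Σℚ-distrib-+ {ℕ.suc m} f g =
  trans (cong (f zero + g zero +_) (Σℚ-distrib-+ (f ∘ suc) (g ∘ suc)))
        (interchange (f zero) (g zero) _ _)

Σℚ-change-at : ∀ {m} {f g : Fin m → ℚ} {d} i →
  (∀ e → e ≢ i → f e ≡ g e) → f i ≡ g i + d → Σℚ f ≡ Σℚ g + d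
Σℚ-change-at {g = g} {d} zero f≗g fi≡gi+d =
  trans (cong₂ _+_ fi≡gi+d (Σℚ-cong (λ e → f≗g (suc e) λ ())))
        (xy∙z≈xz∙y (g zero) d _)
Σℚ-change-at {g = g} {d} (suc i) f≗g fi≡gi+d =
  trans (cong₂ _+_ (f≗g zero λ ()) (Σℚ-change-at i (λ e e≢i → f≗g (suc e) (e≢i ∘ suc-injective)) fi≡gi+d))
        (sym (+-assoc (g zero) _ d))

-- χ F e unfolds to indicator (lookup F e).
indicator : Bool → ℚ
indicator b = if b then 1ℚ else 0ℚ

·χ-insert : ∀ {m} (c : Fin m → ℚ) (K : Subset m) i → lookup K i ≡ false →
  c · χ (K [ i ]≔ true) ≡ c · χ K + c i
·χ-insert c K i Ki = Σℚ-change-at i off at-i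
  where
  open ≡-Reasoning
  off : ∀ e → e ≢ i → c e * χ (K [ i ]≔ true) e ≡ c e * χ K e
  off e e≢i = cong (λ b → c e * indicator b) (lookup∘update′ e≢i K true)
  at-i : c i * χ (K [ i ]≔ true) i ≡ c i * χ K i + c i
  at-i = begin
    c i * indicator (lookup (K [ i ]≔ true) i) ≡⟨ cong (λ b → c i * indicator b) (lookup∘update i K true) ⟩
    c i * 1ℚ                                   ≡⟨ *-identityʳ (c i) ⟩
    c i                                        ≡⟨ +-identityˡ (c i) ⟨
    0ℚ + c i                                   ≡⟨ cong (_+ c i) (*-zeroʳ (c i)) ⟨
    c i * 0ℚ + c i                             ≡⟨ cong (λ b → c i * indicator b + c i) Ki ⟨
    c i * indicator (lookup K i) + c i         ∎

splice-χ : ∀ {m} (S : Fin m → Bool) (A B : Subset m) e →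
  χ (splice S A B) e + χ (splice S B A) e ≡ χ A e + χ B e
splice-χ S A B e with S e in Se
... | true = cong₂ (λ a b → indicator a + indicator b) (splice-inside S A B Se) (splice-inside S B A Se)
... | false = trans (cong₂ (λ a b → indicator a + indicator b) (splice-outside S A B Se) (splice-outside S B A Se))
                    (+-comm (χ B e) (χ A e))

sign : Bool → ℚ
sign true = 1ℚ
sign false = - 1ℚ

Prefers : ℚ → Bool → Bool → Set
Prefers k b b′ = b ≡ b′ ⊎ (0ℚ < k × b′ ≡ true) ⊎ (k < 0ℚ × b′ ≡ false)

prefers-< : ∀ {k b b′} → Prefers k b b′ → b ≢ b′ → k * indicator b < k * indicator b′
prefers-< (inj₁ b≡b′) b≢b′ = ⊥-elim (b≢b′ b≡b′)
prefers-< {k} {false} (inj₂ (inj₁ (0<k , refl))) _ = subst₂ _<_ (sym (*-zeroʳ k)) (sym (*-identityʳ k)) 0<k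
prefers-< {k} {true} (inj₂ (inj₁ (_ , refl))) b≢b′ = ⊥-elim (b≢b′ refl)
prefers-< {k} {true} (inj₂ (inj₂ (k<0 , refl))) _ = subst₂ _<_ (sym (*-identityʳ k)) (sym (*-zeroʳ k)) k<0
prefers-< {k} {false} (inj₂ (inj₂ (_ , refl))) b≢b′ = ⊥-elim (b≢b′ refl)

prefers-≤ : ∀ {k b b′} → Prefers k b b′ → k * indicator b ≤ k * indicator b′
prefers-≤ {b = b} {b′} pref with b Bool.≟ b′
... | yes refl = ≤-refl
... | no b≢b′ = <⇒≤ (prefers-< pref b≢b′)

prefers-sign : ∀ {k b b′ b″} → k ≡ sign b″ → b′ ≡ b″ → Prefers k b b′
prefers-sign {b″ = true} refl refl = inj₂ (inj₁ (positive⁻¹ 1ℚ , refl))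
prefers-sign {b″ = false} refl refl = inj₂ (inj₂ (negative⁻¹ (- 1ℚ) , refl))

prefers-positive : ∀ {k q b b′} .{{_ : Positive q}} → k ≡ q → b′ ≡ true → Prefers k b b′
prefers-positive {q = q} refl b′≡true = inj₂ (inj₁ (positive⁻¹ q , b′≡true))

Dominates : ∀ {m} → (Fin m → ℚ) → Subset m → Subset m → Set
Dominates c W R = ∀ e → Prefers (c e) (lookup W e) (lookup R e)

dominates⇒< : ∀ {m} {c : Fin m → ℚ} {W R} → Dominates c W R → W ≢ R → c · χ W < c · χ R
dominates⇒< dom W≢R =
  let (e , We≢Re) = subset-differ W≢R in
  Σℚ-mono-< (λ e → prefers-≤ (dom e)) e (prefers-< (dom e) We≢Re)

record Quotient {n} (R : Fin n → Fin n → Set) : Set where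
  field
    size : ℕ
    class : Fin n → Fin size
    sound : ∀ {x y} → class x ≡ class y → R x y
    complete : ∀ {x y} → R x y → class x ≡ class y
    onto : ∀ j → ∃ λ x → class x ≡ j

module _ {n} {R : Fin (ℕ.suc n) → Fin (ℕ.suc n) → Set} (equiv : IsEquivalence R) where
  open IsEquivalence equiv renaming (refl to R-refl; sym to R-sym; trans to R-trans)

  private
    Rₛ : Fin n → Fin n → Set
    Rₛ x y = R (suc x) (suc y)

  quotient-join : Quotient Rₛ → ∀ u → R zero (suc u) → Quotient R
  quotient-join Q u 0~u =
    record { size = size ; class = class′ ; sound = sound′ ; complete = complete′ ; onto = onto′ }
    where
    open Quotient Q
    class′ : Fin (ℕ.suc n) → Fin size
    class′ zero = class u
    class′ (suc x) = class x
    sound′ : ∀ {x y} → class′ x ≡ class′ y → R x y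
    sound′ {zero} {zero} _ = R-refl
    sound′ {zero} {suc y} eq = R-trans 0~u (sound eq)
    sound′ {suc x} {zero} eq = R-sym (R-trans 0~u (sound (sym eq)))
    sound′ {suc x} {suc y} eq = sound eq
    complete′ : ∀ {x y} → R x y → class′ x ≡ class′ y
    complete′ {zero} {zero} _ = refl
    complete′ {zero} {suc y} r = complete (R-trans (R-sym 0~u) r)
    complete′ {suc x} {zero} r = sym (complete (R-trans (R-sym 0~u) (R-sym r)))
    complete′ {suc x} {suc y} r = complete r
    onto′ : ∀ j → ∃ λ x → class′ x ≡ j
    onto′ j with onto j
    ... | x , eq = suc x , eq

  quotient-new : Quotient Rₛ → (∀ u → ¬ R zero (suc u)) → Quotient R
  quotient-new Q isolated =
    record { size = ℕ.suc size ; class = class′ ; sound = sound′ ; complete = complete′ ; onto = onto′ }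
    where
    open Quotient Q
    class′ : Fin (ℕ.suc n) → Fin (ℕ.suc size)
    class′ zero = zero
    class′ (suc x) = suc (class x)
    sound′ : ∀ {x y} → class′ x ≡ class′ y → R x y
    sound′ {zero} {zero} _ = R-refl
    sound′ {suc x} {suc y} eq = sound (suc-injective eq)
    complete′ : ∀ {x y} → R x y → class′ x ≡ class′ y
    complete′ {zero} {zero} _ = refl
    complete′ {zero} {suc y} r = ⊥-elim (isolated y r)
    complete′ {suc x} {zero} r = ⊥-elim (isolated x (R-sym r))
    complete′ {suc x} {suc y} r = cong suc (complete r)
    onto′ : ∀ j → ∃ λ x → class′ x ≡ j
    onto′ zero = zero , refl
    onto′ (suc j) with onto j
    ... | x , eq = suc x , cong suc eq

quotient : ∀ {n} {R : Fin n → Fin n → Set} → IsEquivalence R → Decidable R → Quotient R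
quotient {ℕ.zero} _ _ = record { size = 0 ; class = λ () ; sound = λ { {()} } ; complete = λ { {()} } ; onto = λ () }
quotient {ℕ.suc n} {R} equiv R? = extend (quotient restricted λ x y → R? (suc x) (suc y)) (any? (R? zero ∘ suc))
  where
  open IsEquivalence equiv renaming (refl to R-refl; sym to R-sym; trans to R-trans)
  restricted : IsEquivalence λ x y → R (suc x) (suc y)
  restricted = record { refl = R-refl ; sym = R-sym ; trans = R-trans }
  extend : Quotient (λ x y → R (suc x) (suc y)) → Dec (∃ λ u → R zero (suc u)) → Quotient R
  extend Q (yes (u , 0~u)) = quotient-join equiv Q u 0~u
  extend Q (no isolated) = quotient-new equiv Q λ u 0~u → isolated (u , 0~u)

module _ {n m : ℕ} (G : SimpleGraph n m) where
  open SimpleGraph G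

  Touch : Fin m → Fin m → Set
  Touch e f = Meet (ends e) (ends f)

  touch? : ∀ e f → Dec (Touch e f)
  touch? e f = any? λ v → (v ∈₂? ends e) ×-dec (v ∈₂? ends f)

  touch-refl : ∀ e → Touch e e
  touch-refl e = _ , inj₁ refl , inj₁ refl

  disjoint⇒¬touch : ∀ {e f} → Disjoint G e f → ¬ Touch e f
  disjoint⇒¬touch (d , _ , _ , _) (_ , inj₁ refl , inj₁ q) = d q
  disjoint⇒¬touch (_ , d , _ , _) (_ , inj₁ refl , inj₂ q) = d q
  disjoint⇒¬touch (_ , _ , d , _) (_ , inj₂ refl , inj₁ q) = d q
  disjoint⇒¬touch (_ , _ , _ , d) (_ , inj₂ refl , inj₂ q) = d q

  ¬touch⇒disjoint : ∀ {e f} → ¬ Touch e f → Disjoint G e f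
  ¬touch⇒disjoint ¬t = (λ q → ¬t (_ , inj₁ refl , inj₁ q)) , (λ q → ¬t (_ , inj₁ refl , inj₂ q))
                     , (λ q → ¬t (_ , inj₂ refl , inj₁ q)) , (λ q → ¬t (_ , inj₂ refl , inj₂ q))

  matching-intro : ∀ {F} → (∀ e f → lookup F e ≡ true → lookup F f ≡ true → e ≢ f → ¬ Touch e f) →
    IsMatching G F
  matching-intro F-ok e f e∈F f∈F e≢f = ¬touch⇒disjoint (F-ok e f ([]=⇒lookup e∈F) ([]=⇒lookup f∈F) e≢f)

  matching-touch⇒≡ : ∀ {F e f} → IsMatching G F → lookup F e ≡ true → lookup F f ≡ true → Touch e f → e ≡ f
  matching-touch⇒≡ {F} {e} {f} F-ok Fe Ff e~f with e ≟ f
  ... | yes e≡f = e≡f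
  ... | no e≢f = ⊥-elim (disjoint⇒¬touch (F-ok e f (lookup⇒[]= e F Fe) (lookup⇒[]= f F Ff) e≢f) e~f)

  matching-excludes : ∀ {F e f} → IsMatching G F → lookup F e ≡ true → Touch e f → e ≢ f → lookup F f ≡ false
  matching-excludes iF Fe e~f e≢f = ¬-not λ Ff → e≢f (matching-touch⇒≡ iF Fe Ff e~f)

  singleton-matching : ∀ f → IsMatching G (∅ [ f ]≔ true)
  singleton-matching f =
    matching-intro λ x y x∈ y∈ x≢y _ → x≢y (trans (singleton-member x∈) (sym (singleton-member y∈)))

  pair-matching : ∀ {a b} → ¬ Touch a b → IsMatching G (∅ [ a ]≔ true [ b ]≔ true)
  pair-matching {a} {b} a≁b = matching-intro λ x y x∈ y∈ → apart (pair-member x∈) (pair-member y∈)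
    where
    apart : ∀ {x y} → x ∈₂ (a , b) → y ∈₂ (a , b) → x ≢ y → ¬ Touch x y
    apart (inj₁ refl) (inj₁ refl) x≢y = ⊥-elim (x≢y refl)
    apart (inj₁ refl) (inj₂ refl) _ = a≁b
    apart (inj₂ refl) (inj₁ refl) _ = a≁b ∘ Meet-sym
    apart (inj₂ refl) (inj₂ refl) x≢y = ⊥-elim (x≢y refl)

  splice-matching : ∀ {S A B} → (∀ {e f} → Touch e f → S e ≡ S f) → IsMatching G A → IsMatching G B →
    IsMatching G (splice S A B)
  splice-matching {S} {A} {B} S-closed iA iB = matching-intro both-sides
    where
    both-sides : ∀ e f → lookup (splice S A B) e ≡ true → lookup (splice S A B) f ≡ true → e ≢ f → ¬ Touch e f
    both-sides e f e∈ f∈ e≢f e~f with S e in Se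
    ... | true = e≢f (matching-touch⇒≡ iA (trans (sym (splice-inside S A B Se)) e∈)
                                       (trans (sym (splice-inside S A B (trans (sym (S-closed e~f)) Se))) f∈) e~f)
    ... | false = e≢f (matching-touch⇒≡ iB (trans (sym (splice-outside S A B Se)) e∈)
                                        (trans (sym (splice-outside S A B (trans (sym (S-closed e~f)) Se))) f∈) e~f)

  skeletonAdj-byDominance : ∀ {M N} (c : Fin m → ℚ) → IsMatching G M → IsMatching G N → M ≢ N →
    c · χ M ≡ c · χ N →
    (∀ W → IsMatching G W → W ≢ M → W ≢ N → Dominates c W M ⊎ Dominates c W N) →
    SkeletonAdj G M N
  skeletonAdj-byDominance {M} {N} c iM iN M≢N eq dominated = iM , iN , M≢N , c , eq , best
    where
    best : ∀ W → IsMatching G W → W ≢ M → W ≢ N → c · χ W < c · χ M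
    best W iW W≢M W≢N with dominated W iW W≢M W≢N
    ... | inj₁ W≼M = dominates⇒< W≼M W≢M
    ... | inj₂ W≼N = subst (c · χ W <_) (sym eq) (dominates⇒< W≼N W≢N)

  skeletonAdj-unsplittable : ∀ {M N W₁ W₂} → SkeletonAdj G M N → IsMatching G W₁ → IsMatching G W₂ →
    (∀ e → χ W₁ e + χ W₂ e ≡ χ M e + χ N e) → W₁ ≢ M → W₁ ≢ N → W₂ ≢ M → W₂ ≢ N → ⊥
  skeletonAdj-unsplittable {M} {N} {W₁} {W₂} (_ , _ , _ , c , eq , best) iW₁ iW₂ split W₁≢M W₁≢N W₂≢M W₂≢N =
    <-irrefl same (+-mono-< (best W₁ iW₁ W₁≢M W₁≢N) (subst (c · χ W₂ <_) eq (best W₂ iW₂ W₂≢M W₂≢N)))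
    where
    open ≡-Reasoning
    same : c · χ W₁ + c · χ W₂ ≡ c · χ M + c · χ N
    same = begin
      c · χ W₁ + c · χ W₂                    ≡⟨ Σℚ-distrib-+ (λ e → c e * χ W₁ e) (λ e → c e * χ W₂ e) ⟨
      Σℚ (λ e → c e * χ W₁ e + c e * χ W₂ e) ≡⟨ Σℚ-cong (λ e → sym (*-distribˡ-+ (c e) _ _)) ⟩
      Σℚ (λ e → c e * (χ W₁ e + χ W₂ e))     ≡⟨ Σℚ-cong (λ e → cong (c e *_) (split e)) ⟩
      Σℚ (λ e → c e * (χ M e + χ N e))       ≡⟨ Σℚ-cong (λ e → *-distribˡ-+ (c e) _ _) ⟩
      Σℚ (λ e → c e * χ M e + c e * χ N e)   ≡⟨ Σℚ-distrib-+ (λ e → c e * χ M e) (λ e → c e * χ N e) ⟩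
      c · χ M + c · χ N                      ∎

  skeletonAdj-flip : ∀ {M g} → IsMatching G M → IsMatching G (M [ g ]≔ not (lookup M g)) →
    SkeletonAdj G M (M [ g ]≔ not (lookup M g))
  skeletonAdj-flip {M} {g} iM iN =
    skeletonAdj-byDominance c iM iN (≢-witness Mg≢Ng) (Σℚ-cong same-terms) dominated
    where
    N = M [ g ]≔ not (lookup M g)
    Ng : lookup N g ≡ not (lookup M g)
    Ng = lookup∘update g M _
    Mg≢Ng : lookup M g ≢ lookup N g
    Mg≢Ng Mg≡Ng = not-¬ refl (trans Mg≡Ng Ng)
    N-off : ∀ {x} → x ≢ g → lookup N x ≡ lookup M x
    N-off x≢g = lookup∘update′ x≢g M _
    c : Fin m → ℚ
    c x = if does (x ≟ g) then 0ℚ else sign (lookup M x)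
    same-terms : ∀ x → c x * χ M x ≡ c x * χ N x
    same-terms x with x ≟ g
    ... | yes refl = trans (*-zeroˡ (χ M x)) (sym (*-zeroˡ (χ N x)))
    ... | no x≢g = cong (λ b → sign (lookup M x) * indicator b) (sym (N-off x≢g))
    agreeing : ∀ W R → lookup W g ≡ lookup R g → (∀ {x} → x ≢ g → lookup R x ≡ lookup M x) → Dominates c W R
    agreeing W R Wg≡Rg R-off x with x ≟ g
    ... | yes refl = inj₁ Wg≡Rg
    ... | no x≢g = prefers-sign refl (R-off x≢g)
    dominated : ∀ W → IsMatching G W → W ≢ M → W ≢ N → Dominates c W M ⊎ Dominates c W N
    dominated W _ _ _ with lookup W g Bool.≟ lookup M g
    ... | yes Wg≡Mg = inj₁ (agreeing W M Wg≡Mg λ _ → refl)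
    ... | no Wg≢Mg = inj₂ (agreeing W N (trans (¬-not Wg≢Mg) (sym Ng)) N-off)

  skeletonAdj-swap : ∀ {K g h} → Touch g h → g ≢ h → lookup K g ≡ false → lookup K h ≡ false →
    IsMatching G (K [ h ]≔ true) → IsMatching G (K [ g ]≔ true) →
    SkeletonAdj G (K [ h ]≔ true) (K [ g ]≔ true)
  skeletonAdj-swap {K} {g} {h} g~h g≢h Kg Kh iM iN =
    skeletonAdj-byDominance c iM iN (≢-by-member Mg (lookup∘update g K true)) c·M≡c·N dominated
    where
    open ≡-Reasoning
    M = K [ h ]≔ true
    N = K [ g ]≔ true
    Mg : lookup M g ≡ false
    Mg = trans (lookup∘update′ g≢h K true) Kg
    c : Fin m → ℚ
    c x = if does (x ∈₂? (g , h)) then 1ℚ else sign (lookup K x)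
    c-in : ∀ {x} → x ∈₂ (g , h) → c x ≡ 1ℚ
    c-in {x} x∈ = cong (if_then 1ℚ else sign (lookup K x)) (dec-true (x ∈₂? (g , h)) x∈)
    c-out : ∀ {x} → ¬ x ∈₂ (g , h) → c x ≡ sign (lookup K x)
    c-out {x} x∉ = cong (if_then 1ℚ else sign (lookup K x)) (dec-false (x ∈₂? (g , h)) x∉)
    c·M≡c·N : c · χ M ≡ c · χ N
    c·M≡c·N = begin
      c · χ M       ≡⟨ ·χ-insert c K h Kh ⟩
      c · χ K + c h ≡⟨ cong (c · χ K +_) (trans (c-in (inj₂ refl)) (sym (c-in (inj₁ refl)))) ⟩
      c · χ K + c g ≡⟨ ·χ-insert c K g Kg ⟨
      c · χ N       ∎
    dominated : ∀ W → IsMatching G W → W ≢ M → W ≢ N → Dominates c W M ⊎ Dominates c W N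
    dominated W iW _ _ with lookup W g in Wg
    ... | false = inj₁ below-M
      where
      below-M : Dominates c W M
      below-M x with x ∈₂? (g , h)
      ... | yes (inj₁ refl) = inj₁ (trans Wg (sym Mg))
      ... | yes (inj₂ refl) = prefers-positive (c-in (inj₂ refl)) (lookup∘update h K true)
      ... | no x∉ = prefers-sign (c-out x∉) (lookup∘update′ (x∉ ∘ inj₂) K true)
    ... | true = inj₂ below-N
      where
      below-N : Dominates c W N
      below-N x with x ∈₂? (g , h)
      ... | yes (inj₁ refl) = prefers-positive (c-in (inj₁ refl)) (lookup∘update g K true)
      ... | yes (inj₂ refl) = inj₁ (trans (matching-excludes iW Wg g~h g≢h)
                                          (sym (trans (lookup∘update′ (g≢h ∘ sym) K true) Kh)))
      ... | no x∉ = prefers-sign (c-out x∉) (lookup∘update′ (x∉ ∘ inj₁) K true)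

  path-distinct : ∀ {a f b} → Touch a f → Touch f b → ¬ Touch a b → a ≢ f × b ≢ f × a ≢ b
  path-distinct {a} a~f f~b a≁b = (λ { refl → a≁b f~b }) , (λ { refl → a≁b a~f }) , λ { refl → a≁b (touch-refl a) }

  skeletonAdj-path : ∀ {a f b} → Touch a f → Touch f b → ¬ Touch a b →
    SkeletonAdj G (∅ [ f ]≔ true) (∅ [ a ]≔ true [ b ]≔ true)
  skeletonAdj-path {a} {f} {b} a~f f~b a≁b with path-distinct a~f f~b a≁b
  ... | a≢f , b≢f , a≢b =
    skeletonAdj-byDominance c (singleton-matching f) (pair-matching a≁b)
      (≢-by-member (M-out a≢f) (N-in (inj₁ refl))) c·M≡c·N dominated
    where
    open ≡-Reasoning
    M = ∅ [ f ]≔ true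
    A = ∅ [ a ]≔ true
    N = A [ b ]≔ true
    f∉ab : ¬ f ∈₂ (a , b)
    f∉ab (inj₁ f≡a) = a≢f (sym f≡a)
    f∉ab (inj₂ f≡b) = b≢f (sym f≡b)
    M-out : ∀ {x} → x ≢ f → lookup M x ≡ false
    M-out x≢f = ¬-not (x≢f ∘ singleton-member)
    N-in : ∀ {x} → x ∈₂ (a , b) → lookup N x ≡ true
    N-in (inj₁ refl) = trans (lookup∘update′ a≢b A true) (lookup∘update a ∅ true)
    N-in (inj₂ refl) = lookup∘update b A true
    N-out : ∀ {x} → ¬ x ∈₂ (a , b) → lookup N x ≡ false
    N-out x∉ = ¬-not (x∉ ∘ pair-member)
    -- f weighs as much as a and b together.
    c : Fin m → ℚ
    c x = if does (x ≟ f) then 1ℚ + 1ℚ else if does (x ∈₂? (a , b)) then 1ℚ else - 1ℚ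
    c-f : c f ≡ 1ℚ + 1ℚ
    c-f = cong (if_then 1ℚ + 1ℚ else (if does (f ∈₂? (a , b)) then 1ℚ else - 1ℚ)) (dec-true (f ≟ f) refl)
    c-ab : ∀ {x} → x ∈₂ (a , b) → c x ≡ 1ℚ
    c-ab {x} x∈ = trans (cong (if_then 1ℚ + 1ℚ else _) (dec-false (x ≟ f) λ { refl → f∉ab x∈ }))
                        (cong (if_then 1ℚ else - 1ℚ) (dec-true (x ∈₂? (a , b)) x∈))
    c-out : ∀ {x} → x ≢ f → ¬ x ∈₂ (a , b) → c x ≡ sign false
    c-out {x} x≢f x∉ = trans (cong (if_then 1ℚ + 1ℚ else _) (dec-false (x ≟ f) x≢f))
                             (cong (if_then 1ℚ else - 1ℚ) (dec-false (x ∈₂? (a , b)) x∉))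
    c·M≡c·N : c · χ M ≡ c · χ N
    c·M≡c·N = begin
      c · χ M               ≡⟨ ·χ-insert c ∅ f (lookup-replicate f false) ⟩
      c · χ ∅ + c f         ≡⟨ cong (c · χ ∅ +_) c-f ⟩
      c · χ ∅ + (1ℚ + 1ℚ)   ≡⟨ cong (c · χ ∅ +_) (cong₂ _+_ (c-ab (inj₁ refl)) (c-ab (inj₂ refl))) ⟨
      c · χ ∅ + (c a + c b) ≡⟨ +-assoc (c · χ ∅) (c a) (c b) ⟨
      c · χ ∅ + c a + c b   ≡⟨ cong (_+ c b) (·χ-insert c ∅ a (lookup-replicate a false)) ⟨
      c · χ A + c b         ≡⟨ ·χ-insert c A b (¬-not λ b∈A → a≢b (sym (singleton-member b∈A))) ⟨
      c · χ N               ∎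
    position : ∀ x → x ≡ f ⊎ x ∈₂ (a , b) ⊎ (x ≢ f × ¬ x ∈₂ (a , b))
    position x with x ≟ f | x ∈₂? (a , b)
    ... | yes x≡f | _ = inj₁ x≡f
    ... | no _ | yes x∈ = inj₂ (inj₁ x∈)
    ... | no x≢f | no x∉ = inj₂ (inj₂ (x≢f , x∉))
    dominated : ∀ W → IsMatching G W → W ≢ M → W ≢ N → Dominates c W M ⊎ Dominates c W N
    dominated W iW _ _ with lookup W f in Wf
    ... | true = inj₁ below-M
      where
      below-M : Dominates c W M
      below-M x with position x
      ... | inj₁ refl = prefers-positive c-f (lookup∘update f ∅ true)
      ... | inj₂ (inj₁ (inj₁ refl)) =
        inj₁ (trans (matching-excludes iW Wf (Meet-sym a~f) (a≢f ∘ sym)) (sym (M-out a≢f)))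
      ... | inj₂ (inj₁ (inj₂ refl)) = inj₁ (trans (matching-excludes iW Wf f~b (b≢f ∘ sym)) (sym (M-out b≢f)))
      ... | inj₂ (inj₂ (x≢f , x∉)) = prefers-sign (c-out x≢f x∉) (M-out x≢f)
    ... | false = inj₂ below-N
      where
      below-N : Dominates c W N
      below-N x with position x
      ... | inj₁ refl = inj₁ (trans Wf (sym (N-out f∉ab)))
      ... | inj₂ (inj₁ x∈) = prefers-positive (c-ab x∈) (N-in x∈)
      ... | inj₂ (inj₂ (x≢f , x∉)) = prefers-sign (c-out x≢f x∉) (N-out x∉)

  near : Fin m → Fin m → Bool
  near g e = does (touch? e g)

  -- The neighbours of M when touching is transitive: M's choice in the class of g becomes g,
  -- or nothing if it was g.
  toggle : Subset m → Fin m → Subset m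
  toggle M g = splice (near g) (∅ [ g ]≔ not (lookup M g)) M

  toggle-at : ∀ M g → lookup (toggle M g) g ≡ not (lookup M g)
  toggle-at M g = trans (splice-inside (near g) (∅ [ g ]≔ not (lookup M g)) M (dec-true (touch? g g) (touch-refl g)))
                        (lookup∘update g ∅ (not (lookup M g)))

  toggle-near : ∀ {M g e} → e ≢ g → Touch e g → lookup (toggle M g) e ≡ false
  toggle-near {M} {g} {e} e≢g e~g =
    trans (splice-inside (near g) (∅ [ g ]≔ not (lookup M g)) M (dec-true (touch? e g) e~g))
          (trans (lookup∘update′ e≢g ∅ _) (lookup-replicate e false))

  toggle-far : ∀ {M g e} → ¬ Touch e g → lookup (toggle M g) e ≡ lookup M e
  toggle-far {M} {g} {e} e≁g = splice-outside (near g) (∅ [ g ]≔ not (lookup M g)) M (dec-false (touch? e g) e≁g)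

  toggle-member : ∀ {M g e} → lookup (toggle M g) e ≡ true → e ≡ g ⊎ (lookup M e ≡ true × ¬ Touch e g)
  toggle-member {M} {g} {e} e∈ with touch? e g | e ≟ g
  ... | _ | yes e≡g = inj₁ e≡g
  ... | no e≁g | no _ = inj₂ (trans (sym (toggle-far {M} e≁g)) e∈ , e≁g)
  ... | yes e~g | no e≢g = ⊥-elim (false≢true (trans (sym (toggle-near {M} e≢g e~g)) e∈))

  toggle-matching : ∀ {M} g → IsMatching G M → IsMatching G (toggle M g)
  toggle-matching {M} g iM =
    matching-intro λ e f e∈ f∈ → apart (toggle-member {M} e∈) (toggle-member {M} f∈)
    where
    apart : ∀ {e f} → e ≡ g ⊎ (lookup M e ≡ true × ¬ Touch e g) → f ≡ g ⊎ (lookup M f ≡ true × ¬ Touch f g) →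
      e ≢ f → ¬ Touch e f
    apart (inj₁ refl) (inj₁ refl) e≢f _ = e≢f refl
    apart (inj₁ refl) (inj₂ (_ , f≁g)) _ e~f = f≁g (Meet-sym e~f)
    apart (inj₂ (_ , e≁g)) (inj₁ refl) _ e~f = e≁g e~f
    apart (inj₂ (Me , _)) (inj₂ (Mf , _)) e≢f e~f = e≢f (matching-touch⇒≡ iM Me Mf e~f)

  toggle-injective : ∀ {M g g′} → IsMatching G M → toggle M g ≡ toggle M g′ → g ≡ g′
  toggle-injective {M} {g} {g′} iM eq = decide (g ≟ g′) (touch? g g′)
    where
    at : ∀ x → lookup (toggle M g) x ≡ lookup (toggle M g′) x
    at x = cong (λ V → lookup V x) eq
    in-M : ∀ {h h′} → h ≢ h′ → Touch h h′ → lookup (toggle M h) h ≡ lookup (toggle M h′) h → lookup M h ≡ true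
    in-M {h} h≢h′ h~h′ same = not-injective (trans (sym (toggle-at M h)) (trans same (toggle-near {M} h≢h′ h~h′)))
    decide : Dec (g ≡ g′) → Dec (Touch g g′) → g ≡ g′
    decide (yes g≡g′) _ = g≡g′
    decide (no g≢g′) (no g≁g′) =
      ⊥-elim (not-¬ refl (sym (trans (sym (toggle-at M g)) (trans (at g) (toggle-far {M} g≁g′)))))
    decide (no g≢g′) (yes g~g′) =
      matching-touch⇒≡ iM (in-M g≢g′ g~g′ (at g)) (in-M (g≢g′ ∘ sym) (Meet-sym g~g′) (sym (at g′))) g~g′

  toggle-≡ : ∀ M g K {b} → b ≡ not (lookup M g) →
    (∀ {x} → x ≢ g → Touch x g → lookup K x ≡ false) → (∀ {x} → ¬ Touch x g → lookup K x ≡ lookup M x) →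
    toggle M g ≡ K [ g ]≔ b
  toggle-≡ M g K {b} b≡ K-near K-far = subset-ext pointwise
    where
    pointwise : ∀ x → lookup (toggle M g) x ≡ lookup (K [ g ]≔ b) x
    pointwise x with x ≟ g | touch? x g
    ... | yes refl | _ = trans (toggle-at M x) (trans (sym b≡) (sym (lookup∘update x K b)))
    ... | no x≢g | yes x~g = trans (toggle-near {M} x≢g x~g) (sym (trans (lookup∘update′ x≢g K b) (K-near x≢g x~g)))
    ... | no x≢g | no x≁g = trans (toggle-far {M} x≁g) (sym (trans (lookup∘update′ x≢g K b) (K-far x≁g)))

  toggle-adjacent : ∀ {M g} → IsMatching G M →
    (∀ {e e′} → lookup M e ≡ true → lookup M e′ ≡ true → Touch e g → Touch e′ g → e ≡ e′) →
    SkeletonAdj G M (toggle M g)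
  toggle-adjacent {M} {g} iM unique with any? (λ h → (lookup M h Bool.≟ true) ×-dec (¬? (h ≟ g) ×-dec touch? h g))
  ... | no none-near =
    subst (SkeletonAdj G M) (sym toggle≡) (skeletonAdj-flip iM (subst (IsMatching G) toggle≡ (toggle-matching g iM)))
    where
    toggle≡ : toggle M g ≡ M [ g ]≔ not (lookup M g)
    toggle≡ = toggle-≡ M g M refl M-near λ _ → refl
      where
      M-near : ∀ {x} → x ≢ g → Touch x g → lookup M x ≡ false
      M-near {x} x≢g x~g = ¬-not λ Mx → none-near (x , Mx , x≢g , x~g)
  ... | yes (h , Mh , h≢g , h~g) =
    subst₂ (SkeletonAdj G) (insert-removed Mh) (sym toggle≡)
      (skeletonAdj-swap (Meet-sym h~g) (h≢g ∘ sym) Kg Kh iM′ iN′)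
    where
    K = M [ h ]≔ false
    Kh : lookup K h ≡ false
    Kh = lookup∘update h M false
    Kg : lookup K g ≡ false
    Kg = trans (lookup∘update′ (h≢g ∘ sym) M false) (matching-excludes iM Mh h~g h≢g)
    toggle≡ : toggle M g ≡ K [ g ]≔ true
    toggle≡ = toggle-≡ M g K (sym (cong not (matching-excludes iM Mh h~g h≢g))) K-near K-far
      where
      K-near : ∀ {x} → x ≢ g → Touch x g → lookup K x ≡ false
      K-near {x} x≢g x~g with x ≟ h
      ... | yes refl = Kh
      ... | no x≢h = trans (lookup∘update′ x≢h M false) (¬-not λ Mx → x≢h (unique Mx Mh x~g h~g))
      K-far : ∀ {x} → ¬ Touch x g → lookup K x ≡ lookup M x
      K-far x≁g = lookup∘update′ (λ { refl → x≁g h~g }) M false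
    iM′ : IsMatching G (K [ h ]≔ true)
    iM′ = subst (IsMatching G) (sym (insert-removed Mh)) iM
    iN′ : IsMatching G (K [ g ]≔ true)
    iN′ = subst (IsMatching G) toggle≡ (toggle-matching g iM)

  toggle-reaches : ∀ M N h → lookup M h ≢ lookup N h → (∀ {e} → lookup M e ≢ lookup N e → Touch e h) →
    (∀ {e} → e ≢ h → Touch e h → lookup N e ≡ false) → toggle M h ≡ N
  toggle-reaches M N h Mh≢Nh differences-near N-near =
    trans (toggle-≡ M h N (¬-not (Mh≢Nh ∘ sym)) N-near N-far) ([]≔-lookup N h)
    where
    N-far : ∀ {x} → ¬ Touch x h → lookup N x ≡ lookup M x
    N-far {x} x≁h with lookup M x Bool.≟ lookup N x
    ... | yes Mx≡Nx = sym Mx≡Nx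
    ... | no Mx≢Nx = ⊥-elim (x≁h (differences-near Mx≢Nx))

  regular-degree-bound : ∀ {d k M} → SkeletonRegular G d → IsMatching G M → (ψ : Fin k → Subset m) →
    (∀ {i j} → ψ i ≡ ψ j → i ≡ j) → (∀ i → SkeletonAdj G M (ψ i)) → k ℕ.≤ d
  regular-degree-bound {M = M} regular iM ψ ψ-injective ψ-adjacent with regular M iM
  ... | f , _ , _ , covers = injective⇒≤ index-injective
    where
    index : Fin _ → Fin _
    index i = proj₁ (covers (ψ i) (ψ-adjacent i))
    index-injective : ∀ {i j} → index i ≡ index j → i ≡ j
    index-injective {i} {j} eq = ψ-injective (begin
      ψ i         ≡⟨ proj₂ (covers (ψ i) (ψ-adjacent i)) ⟨
      f (index i) ≡⟨ cong f eq ⟩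
      f (index j) ≡⟨ proj₂ (covers (ψ j) (ψ-adjacent j)) ⟩
      ψ j         ∎)
      where open ≡-Reasoning

  -- A path e–f–g with e, g disjoint gives {f} the m + 1 distinct neighbours {e, g} and toggle {f} i.
  regular⇒touch-transitive : SkeletonRegular G m → Transitive Touch
  regular⇒touch-transitive regular {e} {f} {g} e~f f~g with touch? e g
  ... | yes e~g = e~g
  ... | no e≁g with path-distinct e~f f~g e≁g
  ...   | e≢f , g≢f , e≢g = ⊥-elim (ℕ.<-irrefl refl (regular-degree-bound regular iM ψ ψ-injective ψ-adjacent))
    where
    M = ∅ [ f ]≔ true
    iM = singleton-matching f
    pair = ∅ [ e ]≔ true [ g ]≔ true
    ψ : Fin (ℕ.suc m) → Subset m
    ψ zero = pair
    ψ (suc i) = toggle M i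
    ψ-adjacent : ∀ i → SkeletonAdj G M (ψ i)
    ψ-adjacent zero = skeletonAdj-path e~f f~g e≁g
    ψ-adjacent (suc i) = toggle-adjacent iM λ Mx My _ _ → trans (singleton-member Mx) (sym (singleton-member My))
    pair≢toggle : ∀ i → pair ≢ toggle M i
    pair≢toggle i pair≡ = e≢g (trans (is-i e≢f e∈pair) (sym (is-i g≢f (lookup∘update g (∅ [ e ]≔ true) true))))
      where
      e∈pair : lookup pair e ≡ true
      e∈pair = trans (lookup∘update′ e≢g (∅ [ e ]≔ true) true) (lookup∘update e ∅ true)
      is-i : ∀ {x} → x ≢ f → lookup pair x ≡ true → x ≡ i
      is-i {x} x≢f x∈ with toggle-member {M} (trans (sym (cong (λ V → lookup V x) pair≡)) x∈)
      ... | inj₁ x≡i = x≡i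
      ... | inj₂ (Mx , _) = ⊥-elim (x≢f (singleton-member Mx))
    ψ-injective : ∀ {i j} → ψ i ≡ ψ j → i ≡ j
    ψ-injective {zero} {zero} _ = refl
    ψ-injective {zero} {suc j} eq = ⊥-elim (pair≢toggle j eq)
    ψ-injective {suc i} {zero} eq = ⊥-elim (pair≢toggle i (sym eq))
    ψ-injective {suc i} {suc j} eq = cong suc (toggle-injective iM eq)

  adj-by-edge : ∀ {x y h} → x ∈₂ ends h → y ∈₂ ends h → x ≢ y → Adj G x y
  adj-by-edge {h = h} (inj₁ refl) (inj₂ refl) _ = h , inj₁ (refl , refl)
  adj-by-edge {h = h} (inj₂ refl) (inj₁ refl) _ = h , inj₂ (refl , refl)
  adj-by-edge (inj₁ refl) (inj₁ refl) x≢y = ⊥-elim (x≢y refl)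
  adj-by-edge (inj₂ refl) (inj₂ refl) x≢y = ⊥-elim (x≢y refl)

  adj-ends : ∀ {x y} (xy : Adj G x y) → x ∈₂ ends (proj₁ xy) × y ∈₂ ends (proj₁ xy)
  adj-ends (_ , inj₁ (refl , refl)) = inj₁ refl , inj₂ refl
  adj-ends (_ , inj₂ (refl , refl)) = inj₂ refl , inj₁ refl

  adj-≢ : ∀ {x y} → Adj G x y → x ≢ y
  adj-≢ (h , inj₁ (refl , refl)) = loopless h
  adj-≢ (h , inj₂ (refl , refl)) = loopless h ∘ sym

  module _ {k} {p : Fin n → Fin k} (separated : ∀ u v → Adj G u v → p u ≡ p v) where

    ends-together : ∀ h → p (proj₁ (ends h)) ≡ p (proj₂ (ends h))
    ends-together h = separated _ _ (h , inj₁ (refl , refl))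

    touch-same-part : ∀ {e f} → Touch e f → p (proj₁ (ends e)) ≡ p (proj₁ (ends f))
    touch-same-part (v , v∈e , v∈f) = trans (sym (on-edge v∈e)) (on-edge v∈f)
      where
      on-edge : ∀ {v h} → v ∈₂ ends h → p v ≡ p (proj₁ (ends h))
      on-edge (inj₁ refl) = refl
      on-edge {h = h} (inj₂ refl) = sym (ends-together h)

    part-edges-touch : ∀ {j e g} → StarPart G p j ⊎ TrianglePart G p j →
      p (proj₁ (ends e)) ≡ j → p (proj₁ (ends g)) ≡ j → Touch e g
    part-edges-touch {j} (inj₁ (c , _ , star)) e∈j g∈j = c , centre-on e∈j , centre-on g∈j
      where
      centre-on : ∀ {h} → p (proj₁ (ends h)) ≡ j → c ∈₂ ends h
      centre-on {h} h∈j
        with Equivalence.to (star _ _ h∈j (trans (sym (ends-together h)) h∈j)) (h , inj₁ (refl , refl))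
      ... | inj₁ (s≡c , _) = inj₁ (sym s≡c)
      ... | inj₂ (t≡c , _) = inj₂ (sym t≡c)
    part-edges-touch {e = e} {g} (inj₂ (a , b , c , _ , _ , _ , _ , _ , _ , within , _)) e∈j g∈j =
      pairs-in-triple-meet (a , b , c) (loopless e) (loopless g)
        (within _ e∈j) (within _ (trans (sym (ends-together e)) e∈j))
        (within _ g∈j) (within _ (trans (sym (ends-together g)) g∈j))

  partition⇒touch-transitive : DisjointUnionOfStarsAndTriangles G → Transitive Touch
  partition⇒touch-transitive (_ , _ , separated , parts) e~f f~g =
    part-edges-touch separated (parts _) refl
      (sym (trans (touch-same-part separated e~f) (touch-same-part separated f~g)))

  module _ (touch-trans : Transitive Touch) where

    near-closed : ∀ {g e f} → Touch e f → near g e ≡ near g f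
    near-closed e~f = does-⇔ (mk⇔ (touch-trans (Meet-sym e~f)) (touch-trans e~f)) (touch? _ _) (touch? _ _)

    differences-near : ∀ {M N g} → SkeletonAdj G M N → lookup M g ≢ lookup N g →
      ∀ {e} → lookup M e ≢ lookup N e → Touch e g
    differences-near {M} {N} {g} adj@(iM , iN , _) Mg≢Ng {e} Me≢Ne with touch? e g
    ... | yes e~g = e~g
    -- Otherwise recombining M and N inside and outside the class of g gives two other
    -- matchings with the same midpoint.
    ... | no e≁g = ⊥-elim (skeletonAdj-unsplittable adj
                     (splice-matching near-closed iM iN) (splice-matching near-closed iN iM) (splice-χ (near g) M N)
                     (≢-witness λ q → Me≢Ne (trans (sym q) W₁e))
                     (≢-witness λ q → Mg≢Ng (trans (sym W₁g) q))
                     (≢-witness λ q → Mg≢Ng (sym (trans (sym W₂g) q)))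
                     (≢-witness λ q → Me≢Ne (sym (trans (sym q) W₂e))))
      where
      W₁g : lookup (splice (near g) M N) g ≡ lookup M g
      W₁g = splice-inside (near g) M N (dec-true (touch? g g) (touch-refl g))
      W₂g : lookup (splice (near g) N M) g ≡ lookup N g
      W₂g = splice-inside (near g) N M (dec-true (touch? g g) (touch-refl g))
      W₁e : lookup (splice (near g) M N) e ≡ lookup N e
      W₁e = splice-outside (near g) M N (dec-false (touch? e g) e≁g)
      W₂e : lookup (splice (near g) N M) e ≡ lookup M e
      W₂e = splice-outside (near g) N M (dec-false (touch? e g) e≁g)

    toggle-covers : ∀ {M N} → SkeletonAdj G M N → ∃ λ g → toggle M g ≡ N
    toggle-covers {M} {N} adj@(iM , iN , M≢N , _) with subset-differ M≢N
    ... | g₀ , Mg₀≢Ng₀ with any? (λ h → (lookup N h Bool.≟ true) ×-dec (lookup M h Bool.≟ false))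
    ...   | yes (h , Nh , Mh) = h , toggle-reaches M N h Mh≢Nh differences-near-h N-near
      where
      Mh≢Nh : lookup M h ≢ lookup N h
      Mh≢Nh Mh≡Nh = false≢true (trans (sym Mh) (trans Mh≡Nh Nh))
      differences-near-h : ∀ {e} → lookup M e ≢ lookup N e → Touch e h
      differences-near-h d =
        touch-trans (differences-near adj Mg₀≢Ng₀ d) (Meet-sym (differences-near adj Mg₀≢Ng₀ Mh≢Nh))
      N-near : ∀ {e} → e ≢ h → Touch e h → lookup N e ≡ false
      N-near e≢h e~h = matching-excludes iN Nh (Meet-sym e~h) (e≢h ∘ sym)
    ...   | no none-added = g₀ , toggle-reaches M N g₀ Mg₀≢Ng₀ (differences-near adj Mg₀≢Ng₀) N-near
      where
      kept : ∀ {e} → lookup N e ≡ true → lookup M e ≡ true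
      kept {e} Ne = ¬-not λ Me → none-added (e , Ne , Me)
      Mg₀ : lookup M g₀ ≡ true
      Mg₀ = ¬-not λ Mg₀′ → none-added (g₀ , trans (¬-not (Mg₀≢Ng₀ ∘ sym)) (cong not Mg₀′) , Mg₀′)
      N-near : ∀ {e} → e ≢ g₀ → Touch e g₀ → lookup N e ≡ false
      N-near e≢g₀ e~g₀ = ¬-not λ Ne → e≢g₀ (matching-touch⇒≡ iM (kept Ne) Mg₀ e~g₀)

    touch-transitive⇒regular : SkeletonRegular G m
    touch-transitive⇒regular M iM =
      toggle M , (λ _ _ → toggle-injective iM) , (λ g → toggle-adjacent iM unique) , λ _ → toggle-covers
      where
      unique : ∀ {g e e′} → lookup M e ≡ true → lookup M e′ ≡ true → Touch e g → Touch e′ g → e ≡ e′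
      unique Me Me′ e~g e′~g = matching-touch⇒≡ iM Me Me′ (touch-trans e~g (Meet-sym e′~g))

    Linked : Fin n → Fin n → Set
    Linked u v = u ≡ v ⊎ ∃₂ λ e f → u ∈₂ ends e × v ∈₂ ends f × Touch e f

    linked-isEquivalence : IsEquivalence Linked
    linked-isEquivalence = record { refl = inj₁ refl ; sym = linked-sym ; trans = linked-trans }
      where
      linked-sym : ∀ {u v} → Linked u v → Linked v u
      linked-sym (inj₁ refl) = inj₁ refl
      linked-sym (inj₂ (e , f , u∈e , v∈f , e~f)) = inj₂ (f , e , v∈f , u∈e , Meet-sym e~f)
      linked-trans : ∀ {u v w} → Linked u v → Linked v w → Linked u w
      linked-trans (inj₁ refl) vw = vw
      linked-trans uv (inj₁ refl) = uv
      linked-trans (inj₂ (e , f , u∈e , v∈f , e~f)) (inj₂ (f′ , g , v∈f′ , w∈g , f′~g)) =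
        inj₂ (e , g , u∈e , w∈g , touch-trans e~f (touch-trans (_ , v∈f , v∈f′) f′~g))

    linked? : Decidable Linked
    linked? u v = (u ≟ v) ⊎-dec any? λ e → any? λ f → (u ∈₂? ends e) ×-dec ((v ∈₂? ends f) ×-dec touch? e f)

    Star : Fin m → Set
    Star e₀ = ∃ λ z → ∀ {h} → Touch h e₀ → z ∈₂ ends h

    Side : Fin m → Fin n → Fin n → Set
    Side e₀ x y = ∃ λ h → Touch h e₀ × x ∈₂ ends h × y ∈₂ ends h

    record Triangle (e₀ : Fin m) : Set where
      field
        a b c : Fin n
        a≢b : a ≢ b
        a≢c : a ≢ c
        b≢c : b ≢ c
        side-ab : Side e₀ a b
        side-ac : Side e₀ a c
        side-bc : Side e₀ b c
        within : ∀ {h x} → Touch h e₀ → x ∈₂ ends h → x ∈₃ (a , b , c)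

    common-vertex : ∀ {e₀} z → ¬ (∃ λ h → Touch h e₀ × ¬ z ∈₂ ends h) → Star e₀
    common-vertex z none = z , λ {h} h~e₀ → decidable-stable (z ∈₂? ends h) λ z∉h → none (h , h~e₀ , z∉h)

    triangle : ∀ e₀ {f₁ f₂} → Touch f₁ e₀ → ¬ proj₁ (ends e₀) ∈₂ ends f₁ →
      Touch f₂ e₀ → ¬ proj₂ (ends e₀) ∈₂ ends f₂ → Triangle e₀
    triangle e₀ {f₁} {f₂} f₁~e₀ a∉f₁ f₂~e₀ b∉f₂ = record
      { a = a ; b = b ; c = c ; a≢b = loopless e₀ ; a≢c = a≢c ; b≢c = b≢c
      ; side-ab = e₀ , touch-refl e₀ , inj₁ refl , inj₂ refl
      ; side-ac = f₂ , f₂~e₀ , a∈f₂ , c∈f₂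
      ; side-bc = f₁ , f₁~e₀ , b∈f₁ , c∈f₁
      ; within = within
      }
      where
      a = proj₁ (ends e₀)
      b = proj₂ (ends e₀)
      b∈f₁ : b ∈₂ ends f₁
      b∈f₁ = meet-without₁ f₁~e₀ a∉f₁
      c = partner b∈f₁
      c∈f₁ : c ∈₂ ends f₁
      c∈f₁ = partner-∈₂ b∈f₁
      b≢c : b ≢ c
      b≢c = partner-≢ (loopless f₁) b∈f₁
      a∈f₂ : a ∈₂ ends f₂
      a∈f₂ = meet-without₂ f₂~e₀ b∉f₂
      f₁-is-bc : ∀ {v} → v ∈₂ ends f₁ → v ∈₂ (b , c)
      f₁-is-bc = ∈₂-cover b≢c b∈f₁ c∈f₁
      c∈f₂ : c ∈₂ ends f₂
      c∈f₂ = meet-without₁ (meet-map f₁-is-bc (touch-trans f₂~e₀ (Meet-sym f₁~e₀))) b∉f₂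
      a≢c : a ≢ c
      a≢c a≡c = a∉f₁ (subst (_∈₂ ends f₁) (sym a≡c) c∈f₁)
      within : ∀ {h x} → Touch h e₀ → x ∈₂ ends h → x ∈₃ (a , b , c)
      within h~e₀ = pair-meeting-triangle (loopless e₀) a≢c b≢c h~e₀
        (meet-map f₁-is-bc (touch-trans h~e₀ (Meet-sym f₁~e₀)))
        (meet-map (∈₂-cover a≢c a∈f₂ c∈f₂) (touch-trans h~e₀ (Meet-sym f₂~e₀)))

    -- Without a common vertex, some edge f₁ of the class of e₀ = ab avoids a, so it is bc,
    -- and some f₂ avoids b, so it is ac.
    touching-star-or-triangle : ∀ e₀ → Star e₀ ⊎ Triangle e₀
    touching-star-or-triangle e₀ with any? (λ h → touch? h e₀ ×-dec ¬? (proj₁ (ends e₀) ∈₂? ends h))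
    ... | no none₁ = inj₁ (common-vertex _ none₁)
    ... | yes (f₁ , f₁~e₀ , a∉f₁) with any? (λ h → touch? h e₀ ×-dec ¬? (proj₂ (ends e₀) ∈₂? ends h))
    ...   | no none₂ = inj₁ (common-vertex _ none₂)
    ...   | yes (f₂ , f₂~e₀ , b∉f₂) = inj₂ (triangle e₀ f₁~e₀ a∉f₁ f₂~e₀ b∉f₂)

    module _ (Q : Quotient Linked) where
      open Quotient Q

      on-touching-edge : ∀ {w e₀ x} → w ∈₂ ends e₀ → class x ≡ class w → ∃ λ h → Touch h e₀ × x ∈₂ ends h
      on-touching-edge w∈e₀ same with sound same
      ... | inj₁ refl = _ , touch-refl _ , w∈e₀
      ... | inj₂ (e , f , x∈e , w∈f , e~f) = e , touch-trans e~f (_ , w∈f , w∈e₀) , x∈e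

      touching-edge-vertex : ∀ {w e₀ h x} → w ∈₂ ends e₀ → Touch h e₀ → x ∈₂ ends h → class x ≡ class w
      touching-edge-vertex w∈e₀ h~e₀ x∈h = complete (inj₂ (_ , _ , x∈h , w∈e₀ , h~e₀))

      isolated-star : ∀ {w} → (∀ e → ¬ w ∈₂ ends e) → StarPart G class (class w)
      isolated-star {w} isolated = w , refl , λ x y x∈ y∈ →
        mk⇔ (λ xy → ⊥-elim (adj-≢ xy (trans (is-w x∈) (sym (is-w y∈)))))
            (λ { (inj₁ (_ , y≢w)) → ⊥-elim (y≢w (is-w y∈)) ; (inj₂ (_ , x≢w)) → ⊥-elim (x≢w (is-w x∈)) })
        where
        is-w : ∀ {x} → class x ≡ class w → x ≡ w
        is-w same with sound same
        ... | inj₁ x≡w = x≡w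
        ... | inj₂ (_ , f , _ , w∈f , _) = ⊥-elim (isolated f w∈f)

      star-part : ∀ {w e₀} → w ∈₂ ends e₀ → Star e₀ → StarPart G class (class w)
      star-part {w} {e₀} w∈e₀ (z , z∈) =
        z , touching-edge-vertex w∈e₀ (touch-refl e₀) (z∈ (touch-refl e₀)) , λ x y x∈ y∈ → mk⇔ (to x∈) (from x∈ y∈)
        where
        to : ∀ {x y} → class x ≡ class w → Adj G x y → (x ≡ z × y ≢ z) ⊎ (y ≡ z × x ≢ z)
        to x∈ xy with on-touching-edge w∈e₀ x∈
        ... | h , h~e₀ , x∈h with ∈₂-cover (adj-≢ xy) (proj₁ (adj-ends xy)) (proj₂ (adj-ends xy))
                                  (z∈ (touch-trans (_ , proj₁ (adj-ends xy) , x∈h) h~e₀))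
        ...   | inj₁ refl = inj₁ (refl , adj-≢ xy ∘ sym)
        ...   | inj₂ refl = inj₂ (refl , adj-≢ xy)
        from : ∀ {x y} → class x ≡ class w → class y ≡ class w → (x ≡ z × y ≢ z) ⊎ (y ≡ z × x ≢ z) → Adj G x y
        from _ y∈ (inj₁ (refl , y≢z)) with on-touching-edge w∈e₀ y∈
        ... | h , h~e₀ , y∈h = adj-by-edge (z∈ h~e₀) y∈h (y≢z ∘ sym)
        from x∈ _ (inj₂ (refl , x≢z)) with on-touching-edge w∈e₀ x∈
        ... | h , h~e₀ , x∈h = adj-by-edge x∈h (z∈ h~e₀) x≢z

      triangle-part : ∀ {w e₀} → w ∈₂ ends e₀ → Triangle e₀ → TrianglePart G class (class w)
      triangle-part {w} {e₀} w∈e₀ t =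
        a , b , c , a≢b , a≢c , b≢c , first side-ab , second side-ab , second side-ac , inside ,
        adj side-ab a≢b , adj side-ac a≢c , adj side-bc b≢c
        where
        open Triangle t
        first : ∀ {x y} → Side e₀ x y → class x ≡ class w
        first (_ , h~e₀ , x∈h , _) = touching-edge-vertex w∈e₀ h~e₀ x∈h
        second : ∀ {x y} → Side e₀ x y → class y ≡ class w
        second (_ , h~e₀ , _ , y∈h) = touching-edge-vertex w∈e₀ h~e₀ y∈h
        adj : ∀ {x y} → Side e₀ x y → x ≢ y → Adj G x y
        adj (_ , _ , x∈h , y∈h) = adj-by-edge x∈h y∈h
        inside : ∀ x → class x ≡ class w → x ∈₃ (a , b , c)
        inside x x∈ with on-touching-edge w∈e₀ x∈
        ... | _ , h~e₀ , x∈h = within h~e₀ x∈h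

      part-shape : ∀ j → StarPart G class j ⊎ TrianglePart G class j
      part-shape j with onto j
      ... | w , refl with any? (λ e → w ∈₂? ends e)
      ...   | no isolated = inj₁ (isolated-star λ e w∈e → isolated (e , w∈e))
      ...   | yes (e₀ , w∈e₀) with touching-star-or-triangle e₀
      ...     | inj₁ star = inj₁ (star-part w∈e₀ star)
      ...     | inj₂ tri = inj₂ (triangle-part w∈e₀ tri)

    touch-transitive⇒partition : DisjointUnionOfStarsAndTriangles G
    touch-transitive⇒partition = size , class , separated , part-shape Q
      where
      Q = quotient linked-isEquivalence linked?
      open Quotient Q
      separated : ∀ u v → Adj G u v → class u ≡ class v
      separated u v uv = complete (inj₂ (_ , _ , proj₁ (adj-ends uv) , proj₂ (adj-ends uv) , touch-refl _))

proposition4p1 : ∀ {n m : ℕ} (G : SimpleGraph n m) →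
    DisjointUnionOfStarsAndTriangles G ⇔ SkeletonRegular G m
proposition4p1 G = mk⇔
  (touch-transitive⇒regular G ∘ partition⇒touch-transitive G)
  (touch-transitive⇒partition G ∘ regular⇒touch-transitive G)
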